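{- Let $P,Q$ be integers and let $(U_n(P,Q))_{n\ge 0}$ be the Lucas sequence of the first type. Suppose $P$, $Q$ and $n$ are odd. If either $n \equiv 3 \pmod 6$ and $Q \equiv 3 \pmod 4$, or $n \equiv 5 \pmod 6$ and $Q \equiv 1 \pmod 4$, then $U_n(P,Q)$ is not a non-zero perfect square, i.e. there is no nonzero integer $m$ with $U_n(P,Q)=m^2$.
   Context: For fixed integers $P,Q$, the Lucas sequence of the first type is defined by $U_0(P,Q)=0$, $U_1(P,Q)=1$, and $U_n(P,Q)=P\cdot U_{n-1}(P,Q)-Q\cdot U_{n-2}(P,Q)$ for $n\ge 2$. -}

module Defs where

open import Data.Nat using (ℕ; zero; suc)
open import Data.Integer using (ℤ; _+_; _-_; _*_; +_)

U : ℤ → ℤ → ℕ → ℤ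
U P Q zero = + 0
U P Q (suc zero) = + 1
U P Q (suc (suc n)) = P * U P Q (suc n) - Q * U P Q n

module Submission where

-- Everything is read modulo 4.  A square is ≡ 0 or 1 (mod 4),
-- so it suffices to show U_n(P,Q) ≡ 2 or 3 (mod 4) in the two cases of the
-- theorem.  The sequence U(P,Q) modulo d depends only on P and Q modulo d,
-- and an odd P is ≡ 1 or 3 (mod 4) while Q ≡ 3 resp. 1 (mod 4) is given; so
-- only four concrete sequences U(p,q) with p ∈ {1,3} remain.  Each of them
-- returns to (U₀,U₁) = (0,1) modulo 4 after 6 steps, hence is 6-periodic
-- modulo 4, and a direct computation gives U₃ ≡ 2 (mod 4) when q = 3 and
-- U₅ ≡ 3 (mod 4) when q = 1.

open import Defs
open import Data.Nat using (ℕ; _%_)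
open import Data.Integer using (ℤ; _*_; _%ℕ_; +_)
open import Data.Product using (_×_; ∃)
open import Data.Sum using (_⊎_)
open import Relation.Binary.PropositionalEquality using (_≡_; _≢_)
open import Relation.Nullary using (¬_)

open import Data.Empty using (⊥-elim)
import Data.Nat as ℕ
import Data.Nat.Properties as ℕ
open import Data.Nat.DivMod using (m≡m%n+[m/n]*n)
open import Data.Integer using (_+_; _-_; -_; _/ℕ_; 0ℤ; 1ℤ)
open import Data.Integer.DivMod using (a≡a%ℕn+[a/ℕn]*n; n%ℕd<d)
open import Data.Integer.Divisibility.Signed
  using (_∣_; divides; _∣?_; ∣-trans; ∣m⇒∣-m; ∣m∣n⇒∣m+n; ∣m∣n⇒∣m-n; ∣n⇒∣m*n; ∣m⇒∣m*n)
open import Data.Integer.Tactic.RingSolver using (solve-∀)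
open import Data.Product using (_,_; proj₁; proj₂)
open import Data.Sum using (inj₁; inj₂)
open import Relation.Binary.PropositionalEquality
  using (refl; sym; trans; cong; subst; module ≡-Reasoning)
open import Relation.Nullary using (Dec)
open import Relation.Nullary.Decidable using (True; False; toWitness; toWitnessFalse; map′)

-- Congruence modulo d: d divides the difference.  It is a record (rather
-- than a synonym for divisibility) so that x, y and d can be inferred.
infix 4 _≡_mod_
record _≡_mod_ (x y d : ℤ) : Set where
  constructor congruent
  field divides-difference : d ∣ x - y
open _≡_mod_

_≡?_mod_ : ∀ x y d → Dec (x ≡ y mod d)
x ≡? y mod d = map′ congruent divides-difference (d ∣? x - y)

by-computation : ∀ {x y d} {_ : True (x ≡? y mod d)} → x ≡ y mod d
by-computation {_} {_} {_} {holds} = toWitness holds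

refuted-by-computation : ∀ {x y d} {_ : False (x ≡? y mod d)} → ¬ (x ≡ y mod d)
refuted-by-computation {_} {_} {_} {fails} = toWitnessFalse fails

mod-refl : ∀ {d} x → x ≡ x mod d
mod-refl x = congruent (subst (_ ∣_) (sym (x-x≡0 x)) (divides 0ℤ refl))
  where
  x-x≡0 : ∀ x → x - x ≡ 0ℤ
  x-x≡0 = solve-∀

mod-sym : ∀ {d x y} → x ≡ y mod d → y ≡ x mod d
mod-sym {x = x} {y} (congruent d∣x-y) =
  congruent (subst (_ ∣_) (negate-difference x y) (∣m⇒∣-m d∣x-y))
  where
  negate-difference : ∀ x y → - (x - y) ≡ y - x
  negate-difference = solve-∀

mod-trans : ∀ {d x y z} → x ≡ y mod d → y ≡ z mod d → x ≡ z mod d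
mod-trans {x = x} {y} {z} (congruent d∣x-y) (congruent d∣y-z) =
  congruent (subst (_ ∣_) (telescope x y z) (∣m∣n⇒∣m+n d∣x-y d∣y-z))
  where
  telescope : ∀ x y z → (x - y) + (y - z) ≡ x - z
  telescope = solve-∀

mod-sub : ∀ {d x y x′ y′} → x ≡ x′ mod d → y ≡ y′ mod d → x - y ≡ x′ - y′ mod d
mod-sub {x = x} {y} {x′} {y′} (congruent d∣x-x′) (congruent d∣y-y′) =
  congruent (subst (_ ∣_) (regroup x y x′ y′) (∣m∣n⇒∣m-n d∣x-x′ d∣y-y′))
  where
  regroup : ∀ x y x′ y′ → (x - x′) - (y - y′) ≡ (x - y) - (x′ - y′)
  regroup = solve-∀

mod-mul : ∀ {d x y x′ y′} → x ≡ x′ mod d → y ≡ y′ mod d → x * y ≡ x′ * y′ mod d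
mod-mul {x = x} {y} {x′} {y′} (congruent d∣x-x′) (congruent d∣y-y′) =
  congruent (subst (_ ∣_) (product-difference x y x′ y′)
                   (∣m∣n⇒∣m+n (∣n⇒∣m*n x d∣y-y′) (∣m⇒∣m*n y′ d∣x-x′)))
  where
  product-difference : ∀ x y x′ y′ → x * (y - y′) + (x - x′) * y′ ≡ x * y - x′ * y′
  product-difference = solve-∀

mod-divisor : ∀ {d e x y} → e ∣ d → x ≡ y mod d → x ≡ y mod e
mod-divisor e∣d (congruent d∣x-y) = congruent (∣-trans e∣d d∣x-y)

mod-residue : ∀ x d .{{_ : ℕ.NonZero d}} → x ≡ + (x %ℕ d) mod + d
mod-residue x d = congruent (divides (x /ℕ d) (begin
  x - r                   ≡⟨ cong (_- r) (a≡a%ℕn+[a/ℕn]*n x d) ⟩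
  r + x /ℕ d * + d - r    ≡⟨ cancel r (x /ℕ d * + d) ⟩
  x /ℕ d * + d            ∎))
  where
  open ≡-Reasoning
  r = + (x %ℕ d)
  cancel : ∀ r t → r + t - r ≡ t
  cancel = solve-∀

%ℕ⇒mod : ∀ {x r} d .{{_ : ℕ.NonZero d}} → x %ℕ d ≡ r → x ≡ + r mod + d
%ℕ⇒mod {x} d x%d≡r = subst (λ r → x ≡ + r mod + d) x%d≡r (mod-residue x d)

U-mod-parameters : ∀ {d P Q p q} → P ≡ p mod d → Q ≡ q mod d →
  ∀ n → U P Q n ≡ U p q n mod d
U-mod-parameters {d} {P} {Q} {p} {q} P≡p Q≡q n = proj₁ (consecutive n)
  where
  consecutive : ∀ n → U P Q n ≡ U p q n mod d × U P Q (ℕ.suc n) ≡ U p q (ℕ.suc n) mod d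
  consecutive ℕ.zero    = mod-refl 0ℤ , mod-refl 1ℤ
  consecutive (ℕ.suc n) = next , mod-sub (mod-mul P≡p next) (mod-mul Q≡q this)
    where
    this = proj₁ (consecutive n)
    next = proj₂ (consecutive n)

-- A second-order recurrence is determined by two consecutive terms: if
-- U_a ≡ U_b and U_{a+1} ≡ U_{b+1}, then U_{j+a} ≡ U_{j+b} for every j.
U-shift : ∀ {d p q} a b → U p q a ≡ U p q b mod d → U p q (ℕ.suc a) ≡ U p q (ℕ.suc b) mod d →
  ∀ j → U p q (j ℕ.+ a) ≡ U p q (j ℕ.+ b) mod d
U-shift {d} {p} {q} a b Uₐ≡U_b Uₐ₊₁≡U_b₊₁ j = proj₁ (consecutive j)
  where
  consecutive : ∀ j → U p q (j ℕ.+ a) ≡ U p q (j ℕ.+ b) mod d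
                    × U p q (ℕ.suc j ℕ.+ a) ≡ U p q (ℕ.suc j ℕ.+ b) mod d
  consecutive ℕ.zero    = Uₐ≡U_b , Uₐ₊₁≡U_b₊₁
  consecutive (ℕ.suc j) = next , mod-sub (mod-mul (mod-refl p) next) (mod-mul (mod-refl q) this)
    where
    this = proj₁ (consecutive j)
    next = proj₂ (consecutive j)

U-periodic : ∀ {d p q} t .{{_ : ℕ.NonZero t}} →
  U p q t ≡ 0ℤ mod d → U p q (ℕ.suc t) ≡ 1ℤ mod d →
  ∀ n → U p q n ≡ U p q (n % t) mod d
U-periodic {d} {p} {q} t Uₜ≡0 Uₜ₊₁≡1 n =
  subst (λ m → U p q m ≡ U p q (n % t) mod d) (sym (m≡m%n+[m/n]*n n t)) (iterate (n ℕ./ t) (n % t))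
  where
  one-period : ∀ j → U p q (j ℕ.+ t) ≡ U p q j mod d
  one-period j = subst (λ i → U p q (j ℕ.+ t) ≡ U p q i mod d) (ℕ.+-identityʳ j)
                       (U-shift t 0 Uₜ≡0 Uₜ₊₁≡1 j)
  iterate : ∀ k j → U p q (j ℕ.+ k ℕ.* t) ≡ U p q j mod d
  iterate ℕ.zero    j = subst (λ i → U p q i ≡ U p q j mod d) (sym (ℕ.+-identityʳ j)) (mod-refl _)
  iterate (ℕ.suc k) j = subst (λ i → U p q i ≡ U p q j mod d) (sym reassociate)
                              (mod-trans (one-period (j ℕ.+ k ℕ.* t)) (iterate k j))
    where
    reassociate : j ℕ.+ (t ℕ.+ k ℕ.* t) ≡ (j ℕ.+ k ℕ.* t) ℕ.+ t
    reassociate = trans (cong (j ℕ.+_) (ℕ.+-comm t (k ℕ.* t))) (sym (ℕ.+-assoc j (k ℕ.* t) t))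

square-mod-4 : ∀ m → m * m ≡ 0ℤ mod + 4 ⊎ m * m ≡ 1ℤ mod + 4
square-mod-4 m with m %ℕ 4 | n%ℕd<d m 4 | mod-residue m 4
... | 0 | _ | m≡r = inj₁ (mod-trans (mod-mul m≡r m≡r) by-computation)
... | 1 | _ | m≡r = inj₂ (mod-trans (mod-mul m≡r m≡r) by-computation)
... | 2 | _ | m≡r = inj₁ (mod-trans (mod-mul m≡r m≡r) by-computation)
... | 3 | _ | m≡r = inj₂ (mod-trans (mod-mul m≡r m≡r) by-computation)
... | ℕ.suc (ℕ.suc (ℕ.suc (ℕ.suc _))) | ℕ.s≤s (ℕ.s≤s (ℕ.s≤s (ℕ.s≤s ()))) | _

non-square-mod-4 : ∀ {x} r → ¬ (r ≡ 0ℤ mod + 4) → ¬ (r ≡ 1ℤ mod + 4) →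
  x ≡ r mod + 4 → ∀ m → x ≢ m * m
non-square-mod-4 r r≢0 r≢1 x≡r m refl with square-mod-4 m
... | inj₁ m²≡0 = r≢0 (mod-trans (mod-sym x≡r) m²≡0)
... | inj₂ m²≡1 = r≢1 (mod-trans (mod-sym x≡r) m²≡1)

odd-residue : ∀ {P r d} → P %ℕ 2 ≡ 1 → + 2 ∣ d → P ≡ r mod d → r ≡ 1ℤ mod + 2
odd-residue P-odd 2∣d P≡r = mod-trans (mod-sym (mod-divisor 2∣d P≡r)) (%ℕ⇒mod 2 P-odd)

odd-mod-4 : ∀ P → P %ℕ 2 ≡ 1 → P ≡ 1ℤ mod + 4 ⊎ P ≡ + 3 mod + 4
odd-mod-4 P P-odd with P %ℕ 4 | n%ℕd<d P 4 | mod-residue P 4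
... | 0 | _ | P≡r = ⊥-elim (refuted-by-computation (odd-residue P-odd (divides (+ 2) refl) P≡r))
... | 1 | _ | P≡r = inj₁ P≡r
... | 2 | _ | P≡r = ⊥-elim (refuted-by-computation (odd-residue P-odd (divides (+ 2) refl) P≡r))
... | 3 | _ | P≡r = inj₂ P≡r
... | ℕ.suc (ℕ.suc (ℕ.suc (ℕ.suc _))) | ℕ.s≤s (ℕ.s≤s (ℕ.s≤s (ℕ.s≤s ()))) | _

no-square-in-class : ∀ {P Q} p q t .{{_ : ℕ.NonZero t}} j n → P ≡ p mod + 4 → Q ≡ q mod + 4 →
  U p q t ≡ 0ℤ mod + 4 → U p q (ℕ.suc t) ≡ 1ℤ mod + 4 →
  ¬ (U p q j ≡ 0ℤ mod + 4) → ¬ (U p q j ≡ 1ℤ mod + 4) →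
  n % t ≡ j → ∀ m → U P Q n ≢ m * m
no-square-in-class p q t j n P≡p Q≡q Uₜ≡0 Uₜ₊₁≡1 Uⱼ≢0 Uⱼ≢1 n≡j =
  non-square-mod-4 (U p q j) Uⱼ≢0 Uⱼ≢1
    (mod-trans (U-mod-parameters P≡p Q≡q n)
               (subst (λ i → U p q n ≡ U p q i mod + 4) n≡j (U-periodic t Uₜ≡0 Uₜ₊₁≡1 n)))

theorem3p1 : (P Q : ℤ) (n : ℕ) →
    P %ℕ 2 ≡ 1 → Q %ℕ 2 ≡ 1 → n % 2 ≡ 1 →
    ((n % 6 ≡ 3 × Q %ℕ 4 ≡ 3) ⊎ (n % 6 ≡ 5 × Q %ℕ 4 ≡ 1)) →
    ¬ (∃ λ (m : ℤ) → m ≢ + 0 × U P Q n ≡ m * m)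
theorem3p1 P Q n P-odd _ _ (inj₁ (n≡3 , Q≡3)) (m , _ , U≡m²) with odd-mod-4 P P-odd
... | inj₁ P≡1 = no-square-in-class 1ℤ (+ 3) 6 3 n P≡1 (%ℕ⇒mod 4 Q≡3) by-computation by-computation
                   refuted-by-computation refuted-by-computation n≡3 m U≡m²
... | inj₂ P≡3 = no-square-in-class (+ 3) (+ 3) 6 3 n P≡3 (%ℕ⇒mod 4 Q≡3) by-computation by-computation
                   refuted-by-computation refuted-by-computation n≡3 m U≡m²
theorem3p1 P Q n P-odd _ _ (inj₂ (n≡5 , Q≡1)) (m , _ , U≡m²) with odd-mod-4 P P-odd
... | inj₁ P≡1 = no-square-in-class 1ℤ 1ℤ 6 5 n P≡1 (%ℕ⇒mod 4 Q≡1) by-computation by-computation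
                   refuted-by-computation refuted-by-computation n≡5 m U≡m²
... | inj₂ P≡3 = no-square-in-class (+ 3) 1ℤ 6 5 n P≡3 (%ℕ⇒mod 4 Q≡1) by-computation by-computation
                   refuted-by-computation refuted-by-computation n≡5 m U≡m²
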